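{- Let $\mathcal C$ be a category and $n\ge0$. Every isomorphism in $Z^n(\mathcal C)$ is a degeneracy map.
   Context: For $n\ge0$, $[n]=\{0,\dots,n-1\}$; $\Delta_+$ is the category of these finite total orders and order-preserving maps. For order-preserving $f:[n]\to[m]$ define $f^\flat:[m+1]\to[n+1]$ by $f^\flat(i)=\min(\{j\in[n]: f(j)\ge i\}\cup\{n\})$. A zigzag $X$ of length $n$ in a category $\mathcal C$ consists of regular objects $X(r_0),\dots,X(r_n)$, singular objects $X(s_0),\dots,X(s_{n-1})$ and cospans $X(r_i)\to X(s_i)\leftarrow X(r_{i+1})$. A zigzag map $f:X\to Y$ ($X$ of length $n$, $Y$ of length $m$) consists of an order-preserving singular map $f_s:[n]\to[m]$, with regular map $f_r:=f_s^\flat$, regular slices $f(r_i):X(r_{f_r(i)})\to Y(r_i)$ ($0\le i\le m$) and singular slices $f(s_j):X(s_j)\to Y(s_{f_s(j)})$ ($0\le j<n$), such that for each $0\le i<m$: (a) if $f_s^{ -1}(i)$ is nonempty with least element $p$ and greatest $q$, then $f(s_p)\circ(X(r_p)\to X(s_p))=(Y(r_i)\to Y(s_i))\circ f(r_i)$, $f(s_q)\circ(X(r_{q+1})\to X(s_q))=(Y(r_{i+1})\to Y(s_i))\circ f(r_{i+1})$, and $f(s_j)\circ(X(r_{j+1})\to X(s_j))=f(s_{j+1})\circ(X(r_{j+1})\to X(s_{j+1}))$ for $p\le j<q$; (b) if $f_s^{ -1}(i)=\emptyset$, then $(Y(r_i)\to Y(s_i))\circ f(r_i)=(Y(r_{i+1})\to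 Y(s_i))\circ f(r_{i+1})$. Composition: $(g\circ f)_s=g_s\circ f_s$, $(g\circ f)(s_j)=g(s_{f_s(j)})\circ f(s_j)$, $(g\circ f)(r_i)=g(r_i)\circ f(r_{g_r(i)})$. This gives the category $Z(\mathcal C)$; $Z^0(\mathcal C)=\mathcal C$ and $Z^n(\mathcal C)=Z(Z^{n-1}(\mathcal C))$. The functor $\pi:Z(\mathcal D)\to\Delta_+$ sends a zigzag of length $n$ to $[n]$ and $f$ to $f_s$. The slice maps of $f$ are its regular and singular slices. For a functor $p$, a map $f:x\to y$ is $p$-cocartesian if for every $h:x\to y'$ and every $u:p(y)\to p(y')$ with $p(h)=u\circ p(f)$ there is a unique $v:y\to y'$ with $v\circ f=h$ and $p(v)=u$; $f$ is $p$-vertical if $p(f)$ is an identity. Degeneracy maps: in $Z^0(\mathcal C)=\mathcal C$ they are the isomorphisms. For $n\ge1$, with $\pi:Z^n(\mathcal C)=Z(Z^{n-1}(\mathcal C))\to\Delta_+$: a simple degeneracy map is a $\pi$-cocartesian map $f$ with $\pi(f)$ a monomorphism in $\Delta_+$; a parallel degeneracy map is a $\pi$-vertical map all of whose slice maps are degeneracy maps in $Z^{n-1}(\mathcal C)$; the degeneracy maps in $Z^n(\mathcal C)$ are the finite composites of simple and parallel degeneracy maps. -}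

module Defs where

open import Level using (Level; _⊔_) renaming (suc to lsuc)
open import Data.Nat using (ℕ; zero; suc; _≤ᵇ_)
open import Data.Fin using (Fin; zero; suc; toℕ; inject₁)
import Data.Fin as F
open import Data.Bool using (if_then_else_)
open import Data.Product using (Σ; _×_; _,_)
open import Relation.Binary.PropositionalEquality using (_≡_; _≢_; refl; cong; sym; subst)
open import Relation.Binary.Structures using (IsEquivalence)

-- Δ₊ : objects [n] = Fin n, morphisms order-preserving maps

record OP (n m : ℕ) : Set where
  field
    fun  : Fin n → Fin m
    mono : ∀ {i j : Fin n} → i F.≤ j → fun i F.≤ fun j
open OP public

-- f♭(i) = min ({ j ∈ [n] : f j ≥ i } ∪ {n})
flat : ∀ {n m} → (Fin n → Fin m) → Fin (suc m) → Fin (suc n)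
flat {zero}  f i = zero
flat {suc n} f i =
  if toℕ i ≤ᵇ toℕ (f zero) then zero else suc (flat (λ j → f (suc j)) i)

IsMonoΔ : ∀ {n m} → OP n m → Set
IsMonoΔ {n} f = ∀ (k : ℕ) (g g' : OP k n) →
  (∀ x → fun f (fun g x) ≡ fun f (fun g' x)) → ∀ x → fun g x ≡ fun g' x

-- Categories (hom-setoids), and raw categorical structure in which
-- composition and identities are given as relations.

record Category (o h e : Level) : Set (lsuc (o ⊔ h ⊔ e)) where
  infixr 9 _∘_
  infix 4 _≈_
  field
    Obj : Set o
    Hom : Obj → Obj → Set h
    _≈_ : ∀ {a b} → Hom a b → Hom a b → Set e
    id  : ∀ {a} → Hom a a
    _∘_ : ∀ {a b c} → Hom b c → Hom a b → Hom a c
    ≈-equiv   : ∀ {a b} → IsEquivalence (_≈_ {a} {b})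
    assoc     : ∀ {a b c d} {f : Hom a b} {g : Hom b c} {k : Hom c d} →
                (k ∘ g) ∘ f ≈ k ∘ (g ∘ f)
    identityˡ : ∀ {a b} {f : Hom a b} → id ∘ f ≈ f
    identityʳ : ∀ {a b} {f : Hom a b} → f ∘ id ≈ f
    ∘-resp-≈  : ∀ {a b c} {f f' : Hom b c} {g g' : Hom a b} →
                f ≈ f' → g ≈ g' → f ∘ g ≈ f' ∘ g'

record RawCat (o h e : Level) : Set (lsuc (o ⊔ h ⊔ e)) where
  field
    Obj  : Set o
    Hom  : Obj → Obj → Set h
    _≈_  : ∀ {a b} → Hom a b → Hom a b → Set e
    -- Comp f g k : "k = g ∘ f"
    Comp : ∀ {a b c} → Hom a b → Hom b c → Hom a c → Set e
    IsId : ∀ {a} → Hom a a → Set e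

raw : ∀ {o h e} → Category o h e → RawCat o h e
raw C = record
  { Obj = Obj ; Hom = Hom ; _≈_ = _≈_
  ; Comp = λ f g k → k ≈ g ∘ f
  ; IsId = λ k → k ≈ id }
  where open Category C

IsIso : ∀ {o h e} (D : RawCat o h e) {a b : RawCat.Obj D} → RawCat.Hom D a b → Set (h ⊔ e)
IsIso D {a} {b} f =
  Σ (Hom b a) λ g → (Σ (Hom a a) λ k → Comp f g k × IsId k)
                  × (Σ (Hom b b) λ k → Comp g f k × IsId k)
  where open RawCat D

module ZZ {o h e : Level} (D : RawCat o h e) where
  open RawCat D

  tr : ∀ {a a' b b'} → a ≡ a' → b ≡ b' → Hom a b → Hom a' b'
  tr refl refl f = f

  -- commutative square  g1 ∘ f1 = g2 ∘ f2  (endpoints identified along pa, pc)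
  CommSq : ∀ {a b1 c a' b2 c'} → a' ≡ a → c' ≡ c →
           Hom a b1 → Hom b1 c → Hom a' b2 → Hom b2 c' → Set (h ⊔ e)
  CommSq {a} {c = c} pa pc f1 g1 f2 g2 =
    Σ (Hom a c) λ k → Comp f1 g1 k × Comp (tr pa refl f2) (tr refl pc g2) k

  record Zigzag : Set (o ⊔ h) where
    field
      len  : ℕ
      reg  : Fin (suc len) → Obj
      sing : Fin len → Obj
      inl  : (i : Fin len) → Hom (reg (inject₁ i)) (sing i)
      inr  : (i : Fin len) → Hom (reg (suc i)) (sing i)
  open Zigzag public

  MapCond : (X Y : Zigzag) (fs : OP (len X) (len Y)) →
            ((i : Fin (suc (len Y))) → Hom (reg X (flat (fun fs) i)) (reg Y i)) →
            ((j : Fin (len X)) → Hom (sing X j) (sing Y (fun fs j))) → Set (h ⊔ e)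
  MapCond X Y fs rs ss = (i : Fin (len Y)) → CondA i × CondB i
    where
    fr = flat (fun fs)
    CondA : Fin (len Y) → Set (h ⊔ e)
    CondA i = (p q : Fin (len X)) (ep : fun fs p ≡ i) (eq : fun fs q ≡ i) →
      (∀ j → fun fs j ≡ i → (p F.≤ j) × (j F.≤ q)) →
        (Σ (fr (inject₁ i) ≡ inject₁ p) λ e1 →
           CommSq (cong (reg X) e1) (cong (sing Y) (sym ep))
                  (inl X p) (ss p) (rs (inject₁ i)) (inl Y i))
      × (Σ (fr (suc i) ≡ suc q) λ e2 →
           CommSq (cong (reg X) e2) (cong (sing Y) (sym eq))
                  (inr X q) (ss q) (rs (suc i)) (inr Y i))
      × (∀ (j j' : Fin (len X)) → p F.≤ j → j F.< q → toℕ j' ≡ suc (toℕ j) →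
           Σ (inject₁ j' ≡ suc j) λ e3 → Σ (fun fs j' ≡ fun fs j) λ e4 →
             CommSq (cong (reg X) e3) (cong (sing Y) e4)
                    (inr X j) (ss j) (inl X j') (ss j'))
    CondB : Fin (len Y) → Set (h ⊔ e)
    CondB i = (∀ j → fun fs j ≢ i) →
      Σ (fr (suc i) ≡ fr (inject₁ i)) λ e0 →
        CommSq (cong (reg X) e0) refl
               (rs (inject₁ i)) (inl Y i) (rs (suc i)) (inr Y i)

  record ZMap (X Y : Zigzag) : Set (h ⊔ e) where
    field
      fs   : OP (len X) (len Y)
      rs   : (i : Fin (suc (len Y))) → Hom (reg X (flat (fun fs) i)) (reg Y i)
      ss   : (j : Fin (len X)) → Hom (sing X j) (sing Y (fun fs j))
      cond : MapCond X Y fs rs ss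
  open ZMap public

  fr : ∀ {X Y} → ZMap X Y → Fin (suc (len Y)) → Fin (suc (len X))
  fr f = flat (fun (fs f))

  Z≈ : ∀ {X Y} → ZMap X Y → ZMap X Y → Set e
  Z≈ {X} {Y} f g =
    Σ (∀ j → fun (fs f) j ≡ fun (fs g) j) λ eqs →
      (∀ j → ss f j ≈ tr refl (cong (sing Y) (sym (eqs j))) (ss g j))
    × (∀ i → Σ (fr f i ≡ fr g i) λ e0 → rs f i ≈ tr (cong (reg X) (sym e0)) refl (rs g i))

  ZComp : ∀ {X Y W} → ZMap X Y → ZMap Y W → ZMap X W → Set e
  ZComp {X} {Y} {W} f g k =
    Σ (∀ j → fun (fs k) j ≡ fun (fs g) (fun (fs f) j)) λ eqs →
      (∀ j → Comp (ss f j) (ss g (fun (fs f) j))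
                  (tr refl (cong (sing W) (eqs j)) (ss k j)))
    × (∀ i → Σ (fr k i ≡ fr f (fr g i)) λ e0 →
               Comp (rs f (fr g i)) (rs g i) (tr (cong (reg X) e0) refl (rs k i)))

  ZId : ∀ {X} → ZMap X X → Set e
  ZId {X} f =
    Σ (∀ j → fun (fs f) j ≡ j) λ eqs →
      (∀ j → IsId (tr refl (cong (sing X) (eqs j)) (ss f j)))
    × (∀ i → Σ (fr f i ≡ i) λ e0 → IsId (tr (cong (reg X) e0) refl (rs f i)))

  Z : RawCat (o ⊔ h) (h ⊔ e) e
  Z = record { Obj = Zigzag ; Hom = ZMap ; _≈_ = Z≈ ; Comp = ZComp ; IsId = ZId }

  IsVertical : ∀ {X Y} → ZMap X Y → Set
  IsVertical {X} {Y} f =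
    Σ (len X ≡ len Y) λ p → ∀ j → fun (fs f) j ≡ subst Fin p j

  IsCocart : ∀ {X Y} → ZMap X Y → Set (o ⊔ h ⊔ e)
  IsCocart {X} {Y} f =
    ∀ {Y'} (k : ZMap X Y') (u : OP (len Y) (len Y')) →
      (∀ j → fun (fs k) j ≡ fun u (fun (fs f) j)) →
      Σ (ZMap Y Y') λ v →
        (ZComp f v k × (∀ i → fun (fs v) i ≡ fun u i))
        × (∀ v' → ZComp f v' k → (∀ i → fun (fs v') i ≡ fun u i) → Z≈ v' v)

  data DegenC {p : Level} (P : ∀ {a b} → Hom a b → Set p) :
       ∀ {X Y : Zigzag} → ZMap X Y → Set (o ⊔ h ⊔ e ⊔ p) where
    simple   : ∀ {X Y} {f : ZMap X Y} → IsCocart f → IsMonoΔ (fs f) → DegenC P f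
    parallel : ∀ {X Y} {f : ZMap X Y} → IsVertical f →
               (∀ i → P (rs f i)) → (∀ j → P (ss f j)) → DegenC P f
    comp     : ∀ {X Y W} {f : ZMap X Y} {g : ZMap Y W} {k : ZMap X W} →
               DegenC P f → DegenC P g → ZComp f g k → DegenC P k

hL : Level → Level → ℕ → Level
hL h e zero    = h
hL h e (suc n) = hL h e n ⊔ e

oL : Level → Level → Level → ℕ → Level
oL o h e zero    = o
oL o h e (suc n) = oL o h e n ⊔ hL h e n

Zⁿ : ∀ {o h e} (n : ℕ) → RawCat o h e → RawCat (oL o h e n) (hL h e n) e
Zⁿ zero    D = D
Zⁿ (suc n) D = ZZ.Z (Zⁿ n D)

dL : Level → Level → Level → ℕ → Level
dL o h e zero    = h ⊔ e
dL o h e (suc n) = oL o h e n ⊔ hL h e n ⊔ e ⊔ dL o h e n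

Degen : ∀ {o h e} (n : ℕ) (C : Category o h e) {a b : RawCat.Obj (Zⁿ n (raw C))} →
        RawCat.Hom (Zⁿ n (raw C)) a b → Set (dL o h e n)
Degen zero    C f = IsIso (raw C) f
Degen (suc n) C f = ZZ.DegenC (Zⁿ n (raw C)) (Degen n C) f

-- An isomorphism f of Z(D) has an inverse g, so its singular map is an invertible
-- order-preserving map of finite ordinals, hence an identity: f is π-vertical. The
-- equations g ∘ f = id and f ∘ g = id hold slicewise, so every slice of f is an
-- isomorphism in D, hence by induction a degeneracy map; f is then a parallel degeneracy.
module Submission where

open import Defs
open import Data.Nat using (ℕ; zero; suc)
open import Data.Fin using (Fin; toℕ)
import Data.Fin as F
open import Data.Fin.Properties
  using (injective⇒existsPivot; cantor-schröder-bernstein; toℕ-injective; toℕ-cast; subst-is-cast)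
open import Data.Nat.Properties using (≤-trans; ≤-antisym)
open import Data.Product using (Σ; _,_)
open import Function.Definitions using (Injective)
open import Relation.Binary.PropositionalEquality

leftInverse⇒injective : ∀ {A B : Set} {f : A → B} (g : B → A) →
                        (∀ x → g (f x) ≡ x) → Injective _≡_ _≡_ f
leftInverse⇒injective g gf≡id {x} {y} fx≡fy =
  trans (sym (gf≡id x)) (trans (cong g fx≡fy) (gf≡id y))

op-injective⇒inflationary : ∀ {n m} (φ : OP n m) → Injective _≡_ _≡_ (fun φ) → ∀ i → i F.≤ fun φ i
op-injective⇒inflationary φ φ-inj i with injective⇒existsPivot φ-inj i
... | j , j≤i , i≤φj = ≤-trans i≤φj (mono φ j≤i)

module _ {n m : ℕ} (φ : OP n m) (ψ : OP m n)
       (ψφ≡id : ∀ i → fun ψ (fun φ i) ≡ i) (φψ≡id : ∀ j → fun φ (fun ψ j) ≡ j) where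

  private
    φ-injective : Injective _≡_ _≡_ (fun φ)
    φ-injective = leftInverse⇒injective (fun ψ) ψφ≡id

    ψ-injective : Injective _≡_ _≡_ (fun ψ)
    ψ-injective = leftInverse⇒injective (fun φ) φψ≡id

  op-inverse⇒toℕ-fixed : ∀ i → toℕ (fun φ i) ≡ toℕ i
  op-inverse⇒toℕ-fixed i = ≤-antisym φi≤i (op-injective⇒inflationary φ φ-injective i)
    where
    φi≤i : fun φ i F.≤ i
    φi≤i = subst (fun φ i F.≤_) (ψφ≡id i) (op-injective⇒inflationary ψ ψ-injective (fun φ i))

  op-inverse⇒identity : Σ (n ≡ m) λ n≡m → ∀ i → fun φ i ≡ subst Fin n≡m i
  op-inverse⇒identity = n≡m , λ i → toℕ-injective (begin
      toℕ (fun φ i)          ≡⟨ op-inverse⇒toℕ-fixed i ⟩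
      toℕ i                  ≡⟨ sym (toℕ-cast n≡m i) ⟩
      toℕ (F.cast n≡m i)     ≡⟨ cong toℕ (sym (subst-is-cast n≡m i)) ⟩
      toℕ (subst Fin n≡m i)  ∎)
    where
    open ≡-Reasoning
    n≡m : n ≡ m
    n≡m = cantor-schröder-bernstein φ-injective ψ-injective

module _ {o h e} (D : RawCat o h e) where
  open RawCat D
  open ZZ D

  -- The inverse of a slice of f is a slice of its inverse taken at a shifted index, so the
  -- two composites are identities only after transport along index equalities; matching
  -- those equalities on refl makes the indices coincide.
  covariant-slice-isIso :
    ∀ {I J : Set} (S : I → Obj) (T : J → Obj) {φ : I → J}
    (F : ∀ i → Hom (S i) (T (φ i))) {j x : I} (G : Hom (T (φ j)) (S x))
    {κ : I} {K : Hom (S j) (S κ)} {κ' : J} {K' : Hom (T (φ j)) (T κ')} →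
    Σ (κ ≡ x) (λ κ≡x → Comp (F j) G (tr refl (cong S κ≡x) K)) →
    Σ (κ ≡ j) (λ κ≡j → IsId (tr refl (cong S κ≡j) K)) →
    Σ (κ' ≡ φ x) (λ κ'≡φx → Comp G (F x) (tr refl (cong T κ'≡φx) K')) →
    Σ (κ' ≡ φ j) (λ κ'≡φj → IsId (tr refl (cong T κ'≡φj) K')) →
    IsIso D (F j)
  covariant-slice-isIso S T F G {K = K} {K' = K'}
    (refl , GF≈K) (refl , K≈id) (refl , FG≈K') (refl , K'≈id) =
    G , (K , GF≈K , K≈id) , (K' , FG≈K' , K'≈id)

  contravariant-slice-isIso :
    ∀ {I J : Set} (S : I → Obj) (T : J → Obj) {α : J → I}
    (F : ∀ i → Hom (S (α i)) (T i)) {i x : J} (G : Hom (T x) (S (α i)))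
    {κ : I} {K : Hom (S κ) (S (α i))} {κ' : J} {K' : Hom (T κ') (T i)} →
    Σ (κ ≡ α x) (λ κ≡αx → Comp (F x) G (tr (cong S κ≡αx) refl K)) →
    Σ (κ ≡ α i) (λ κ≡αi → IsId (tr (cong S κ≡αi) refl K)) →
    Σ (κ' ≡ x) (λ κ'≡x → Comp G (F i) (tr (cong T κ'≡x) refl K')) →
    Σ (κ' ≡ i) (λ κ'≡i → IsId (tr (cong T κ'≡i) refl K')) →
    IsIso D (F i)
  contravariant-slice-isIso S T F G {K = K} {K' = K'}
    (refl , GF≈K) (refl , K≈id) (refl , FG≈K') (refl , K'≈id) =
    G , (K , GF≈K , K≈id) , (K' , FG≈K' , K'≈id)

  module _ {X Y : Zigzag} (f : ZMap X Y) where

    isIso⇒vertical : IsIso Z f → IsVertical f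
    isIso⇒vertical (g , (_ , (gf≡ , _) , (gf≡id , _)) , (_ , (fg≡ , _) , (fg≡id , _))) =
      op-inverse⇒identity (fs f) (fs g)
        (λ j → trans (sym (gf≡ j)) (gf≡id j))
        (λ j → trans (sym (fg≡ j)) (fg≡id j))

    isIso⇒singularSlice-isIso : IsIso Z f → ∀ j → IsIso D (ss f j)
    isIso⇒singularSlice-isIso
      (g , (_ , (gf≡ , gf , _) , (gf≡id , gf-id , _)) , (_ , (fg≡ , fg , _) , (fg≡id , fg-id , _))) j =
      covariant-slice-isIso (sing X) (sing Y) (ss f) (ss g j′)
        (gf≡ j , gf j) (gf≡id j , gf-id j) (fg≡ j′ , fg j′) (fg≡id j′ , fg-id j′)
      where j′ = fun (fs f) j

    isIso⇒regularSlice-isIso : IsIso Z f → ∀ i → IsIso D (rs f i)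
    isIso⇒regularSlice-isIso
      (g , (_ , (_ , _ , gf) , (_ , _ , gf-id)) , (_ , (_ , _ , fg) , (_ , _ , fg-id))) i =
      contravariant-slice-isIso (reg X) (reg Y) (rs f) (rs g i′) (gf i′) (gf-id i′) (fg i) (fg-id i)
      where i′ = fr f i

lemma3p4 : ∀ {o h e} (C : Category o h e) (n : ℕ) {X Y : RawCat.Obj (Zⁿ n (raw C))}
             (f : RawCat.Hom (Zⁿ n (raw C)) X Y) →
             IsIso (Zⁿ n (raw C)) f → Degen n C f
lemma3p4 C zero    f f-iso = f-iso
lemma3p4 C (suc n) f f-iso =
  parallel (isIso⇒vertical D f f-iso)
    (λ i → lemma3p4 C n (rs f i) (isIso⇒regularSlice-isIso D f f-iso i))
    (λ j → lemma3p4 C n (ss f j) (isIso⇒singularSlice-isIso D f f-iso j))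
  where
  D = Zⁿ n (raw C)
  open ZZ D using (parallel; rs; ss)
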